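{- Let $R$ be a cubiculated region with associated graph $G_R$, and let $\mathbb{K}$ be a field. If the toric ideal $I_{G_R}$ is generated by binomials of degree at most $d$, then the set $\mathcal{T}_R$ of domino tilings of $R$ is connected by moves of size at most $d$.
   Context: A cubiculated region $R$ is an $n$-dimensional homogeneous cubical complex embedded in $\mathbb{R}^N$ whose elementary $n$-cubes are unit lattice cubes. A domino is a pair of elementary $n$-cubes of $R$ sharing an $(n-1)$-face; $\mathcal{D}_R$ is the set of dominoes in $R$; a domino tiling is a set $T\subseteq\mathcal{D}_R$ covering every elementary cube exactly once, and $\mathcal{T}_R$ is the set of all tilings. $G_R$ has one vertex per elementary cube and an edge between cubes sharing an $(n-1)$-face, so dominoes are edges of $G_R$ and tilings are perfect matchings of $G_R$. A move is an ordered pair $M=(D_1,D_2)$ of subsets of $\mathcal{D}_R$; applied to a tiling $T_1$ it gives $T_1+M=(T_1\setminus D_1)\cup D_2$. The move has size $d$ if $|D_1|=|D_2|=d$. A set of moves $\mathcal{M}$ connects $\mathcal{T}_R$ if for all $T_1,T_2\in\mathcal{T}_R$ there are $M_1,\dots,M_r\in\mathcal{M}$ with $T_2=T_1+M_1+\dots+M_r$ and $T_1+M_1+\dots+M_s\in\mathcal{T}_R$ for all $1\le s\le r$. The toric ideal $I_{G}$ of a graph $G$ is the kernel of the ring map $\mathbb{K}[y_e: e\in E(G)]\to\mathbb{K}[x_v:v\in V(G)]$, $y_{\{i,j\}}\mapsto x_ix_j$. -}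

module Defs where

open import Level using (_⊔_) renaming (suc to lsuc)
open import Algebra.Bundles using (CommutativeRing)
open import Data.Nat as ℕ using (ℕ; _≤_)
open import Data.Integer as ℤ using (ℤ)
open import Data.Fin as Fin using (Fin)
open import Data.Fin.Properties using (any?) renaming (_<?_ to _<F?_)
open import Data.Fin.Subset using (Subset; _∈_; ∣_∣; _∪_; _∩_; ∁; outside)
open import Data.Fin.Subset.Properties using (_∈?_)
open import Data.Vec as Vec using (Vec; lookup; tabulate; updateAt; _[_]≔_)
import Data.Vec.Properties as VecP
open import Data.Nat.ListAction using () renaming (sum to sumℕ)
open import Data.List as List using (List; []; _∷_; _++_)
open import Data.Product using (_×_; _,_; proj₁; proj₂; ∃; ∃-syntax; Σ)
import Data.Product.Properties as ProdP
open import Data.Sum using (_⊎_; inj₁; inj₂)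
open import Data.Bool as Bool using (Bool; true; false; if_then_else_)
open import Relation.Nullary using (¬_; Dec; yes; no)
open import Relation.Nullary.Decidable using (⌊_⌋; _×-dec_; _⊎-dec_; map′)
open import Relation.Binary.PropositionalEquality using (_≡_; refl)

record Field c ℓ : Set (lsuc (c ⊔ ℓ)) where
  field
    commutativeRing : CommutativeRing c ℓ
  open CommutativeRing commutativeRing public
  field
    1≉0     : ¬ (1# ≈ 0#)
    inverse : ∀ x → ¬ (x ≈ 0#) → ∃[ y ] (x * y ≈ 1#)

-- Elementary cubes in ℝ^N with integer (lattice) vertices.
-- A unit lattice k-cube  a + [0,1]^S  (a ∈ ℤ^N, S ⊆ {1..N}, |S| = k)
-- is represented by the pair (a , S); this representation is unique.

LatticeCube : ℕ → Set
LatticeCube N = Vec ℤ N × Subset N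

-- The (k-1)-face of the cube (a , S) obtained by fixing the coordinate
-- i ∈ S to a_i (ε = false) or to a_i + 1 (ε = true).
facet : ∀ {N} → LatticeCube N → Fin N → Bool → LatticeCube N
facet (a , S) i ε =
  (if ε then updateAt a i (λ z → z ℤ.+ ℤ.1ℤ) else a) , (S [ i ]≔ outside)

ShareFacet : ∀ {N} → LatticeCube N → LatticeCube N → Set
ShareFacet {N} c c' =
  ∃[ i ] ∃[ j ] ∃[ ε ] ∃[ δ ]
    (i ∈ proj₂ c × j ∈ proj₂ c' × facet c i ε ≡ facet c' j δ)

anyBool? : ∀ {p} {P : Bool → Set p} → (∀ b → Dec (P b)) → Dec (∃ P)
anyBool? {P = P} P? = map′ to from (P? true ⊎-dec P? false)
  where
  to : P true ⊎ P false → ∃ P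
  to (inj₁ x) = true , x
  to (inj₂ x) = false , x
  from : ∃ P → P true ⊎ P false
  from (true , x) = inj₁ x
  from (false , x) = inj₂ x

_≟C_ : ∀ {N} (c c' : LatticeCube N) → Dec (c ≡ c')
_≟C_ = ProdP.≡-dec (VecP.≡-dec ℤ._≟_) (VecP.≡-dec Bool._≟_)

shareFacet? : ∀ {N} (c c' : LatticeCube N) → Dec (ShareFacet c c')
shareFacet? c c' =
  any? λ i → any? λ j → anyBool? λ ε → anyBool? λ δ →
    (i ∈? proj₂ c) ×-dec ((j ∈? proj₂ c') ×-dec (facet c i ε ≟C facet c' j δ))

-- A cubiculated region of dimension n in ℝ^N: a finite homogeneous
-- cubical complex, given by its (pairwise distinct) elementary n-cubes.

record Region (n N : ℕ) : Set where
  field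
    m         : ℕ
    cubes     : Vec (LatticeCube N) m
    dimension : ∀ i → ∣ proj₂ (lookup cubes i) ∣ ≡ n
    distinct  : ∀ i j → lookup cubes i ≡ lookup cubes j → i ≡ j

record Graph : Set where
  field
    V    : ℕ
    E    : ℕ
    ends : Fin E → Fin V × Fin V

-- The graph G_R: vertices = elementary cubes, edges = dominoes, i.e.
-- unordered pairs {i , j} (listed once, with i < j) of cubes sharing an
-- (n-1)-face.
module _ {n N : ℕ} (R : Region n N) where
  open Region R

  Adjacent : Fin m × Fin m → Set
  Adjacent (i , j) = (i Fin.< j) × ShareFacet (lookup cubes i) (lookup cubes j)

  adjacent? : ∀ p → Dec (Adjacent p)
  adjacent? (i , j) = (i <F? j) ×-dec shareFacet? (lookup cubes i) (lookup cubes j)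

  dominoList : List (Fin m × Fin m)
  dominoList = List.filter adjacent? (List.cartesianProduct (List.allFin m) (List.allFin m))

  graphOf : Graph
  graphOf = record { V = m ; E = List.length dominoList ; ends = List.lookup dominoList }

module _ (G : Graph) where
  open Graph G

  -- number of endpoints of edge e equal to v (so x^{image} = x_i x_j)
  incidence : Fin E → Fin V → ℕ
  incidence e v =
    (if ⌊ proj₁ (ends e) Fin.≟ v ⌋ then 1 else 0) ℕ.+
    (if ⌊ proj₂ (ends e) Fin.≟ v ⌋ then 1 else 0)

  coverCount : Subset E → Fin V → ℕ
  coverCount T v =
    sumℕ (List.map (λ e → if lookup T e then incidence e v else 0) (List.allFin E))

  IsTiling : Subset E → Set
  IsTiling T = ∀ v → coverCount T v ≡ 1

  Move : Set
  Move = Subset E × Subset E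

  _+M_ : Subset E → Move → Subset E
  T +M (D₁ , D₂) = (T ∩ ∁ D₁) ∪ D₂

  SizeAtMost : ℕ → Move → Set
  SizeAtMost d (D₁ , D₂) = (∣ D₁ ∣ ≡ ∣ D₂ ∣) × (∣ D₁ ∣ ≤ d)

  data Reachable (d : ℕ) : Subset E → Subset E → Set where
    done : ∀ {T} → Reachable d T T
    step : ∀ {T T'} (M : Move) → SizeAtMost d M → IsTiling (T +M M) →
           Reachable d (T +M M) T' → Reachable d T T'

  TilingsConnectedBySizeAtMost : ℕ → Set
  TilingsConnectedBySizeAtMost d =
    ∀ T₁ T₂ → IsTiling T₁ → IsTiling T₂ → Reachable d T₁ T₂

-- Polynomials over a commutative ring in k variables y_0 … y_{k-1}:
-- formal finite sums of terms a·y^α, compared by their coefficients.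

module Poly {c ℓ} (K : CommutativeRing c ℓ) where
  open CommutativeRing K

  Monomial : ℕ → Set
  Monomial k = Vec ℕ k

  degree : ∀ {k} → Monomial k → ℕ
  degree = Vec.sum

  Polynomial : ℕ → Set c
  Polynomial k = List (Carrier × Monomial k)

  coeff : ∀ {k} → Polynomial k → Monomial k → Carrier
  coeff []            α = 0#
  coeff ((a , β) ∷ p) α =
    if ⌊ VecP.≡-dec ℕ._≟_ β α ⌋ then a + coeff p α else coeff p α

  _≈P_ : ∀ {k} → Polynomial k → Polynomial k → Set ℓ
  p ≈P q = ∀ α → coeff p α ≈ coeff q α

  0P : ∀ {k} → Polynomial k
  0P = []

  _+P_ : ∀ {k} → Polynomial k → Polynomial k → Polynomial k
  _+P_ = _++_

  _*P_ : ∀ {k} → Polynomial k → Polynomial k → Polynomial k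
  p *P q = List.concatMap
    (λ t → List.map (λ s → (proj₁ t * proj₁ s , Vec.zipWith ℕ._+_ (proj₂ t) (proj₂ s))) q) p

  sumP : ∀ {k r} → Vec (Polynomial k) r → Polynomial k
  sumP = Vec.foldr _ _+P_ 0P

  binomial : ∀ {k} → Monomial k → Monomial k → Polynomial k
  binomial u v = (1# , u) ∷ (- 1# , v) ∷ []

  InIdeal : ∀ {k r} → Vec (Polynomial k) r → Polynomial k → Set (c ⊔ ℓ)
  InIdeal {k} {r} gs p = Σ (Vec (Polynomial k) r) λ qs → (p ≈P sumP (Vec.zipWith _*P_ qs gs))

  -- toric ideal of a graph:  kernel of  K[y_e] → K[x_v],  y_{ij} ↦ x_i x_j
  module _ (G : Graph) where
    open Graph G

    imageMonomial : Monomial E → Monomial V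
    imageMonomial α = tabulate λ v →
      sumℕ (List.map (λ e → lookup α e ℕ.* incidence G e v) (List.allFin E))

    toricMap : Polynomial E → Polynomial V
    toricMap = List.map (λ t → proj₁ t , imageMonomial (proj₂ t))

    InToricIdeal : Polynomial E → Set ℓ
    InToricIdeal p = toricMap p ≈P 0P

    ToricIdealGeneratedInDegreeAtMost : ℕ → Set (c ⊔ ℓ)
    ToricIdealGeneratedInDegreeAtMost d =
      ∃[ r ] Σ (Vec (Monomial E × Monomial E) r) λ gens →
        (∀ i → degree (proj₁ (lookup gens i)) ≤ d
             × degree (proj₂ (lookup gens i)) ≤ d
             × InToricIdeal (binomial (proj₁ (lookup gens i)) (proj₂ (lookup gens i))))
        × (∀ p → InToricIdeal p →
             InIdeal (Vec.map (λ uv → binomial (proj₁ uv) (proj₂ uv)) gens) p)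

module Submission where

-- A tiling T is identified with the squarefree monomial y^T, and tilings are
-- exactly the monomials y^α whose image under y_e ↦ x_i x_j is x_1 ⋯ x_V
-- ('CoversOnce').  For two tilings T₁, T₂ the binomial y^T₁ - y^T₂ lies in
-- I_G, hence equals Σᵢ qᵢ (y^uᵢ - y^vᵢ) for generators of degree ≤ d.
-- (1) Algebra (Diaconis–Sturmfels): summing coefficients over the connected
--     component of T₁ in the graph with edges (w + uᵢ , w + vᵢ), y^w a
--     monomial of qᵢ, gives 1 on the left and 0 on the right unless T₂ lies
--     in that component ('binomial-joined').
-- (2) Geometry: along each such edge, y^(w+uᵢ) ↦ y^(w+vᵢ) turns a tiling
--     into a tiling by a single move (supp uᵢ , supp vᵢ) of size ≤ d
--     ('exchange-leads').

open import Defs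
open import Algebra.Bundles using (CommutativeRing)
open import Data.Bool using (Bool; true; false; if_then_else_; _∧_; _∨_; not)
open import Data.Empty using (⊥-elim)
open import Data.Fin as Fin using (Fin)
open import Data.Fin.Subset using (Subset; ∣_∣; _∪_; _∩_; ∁)
open import Data.List as List using (List; _++_)
import Data.List.Properties as ListP
open import Data.List.Relation.Unary.All as All using (All; []; _∷_)
import Data.List.Relation.Unary.All.Properties as AllP
open import Data.Nat as ℕ using (ℕ; zero; suc; z≤n; s≤s; _≤_)
import Data.Nat.Properties as ℕP
open import Data.Nat.ListAction using () renaming (sum to sumℕ)
open import Data.Product using (_×_; _,_; proj₁; proj₂)
open import Data.Sum using (_⊎_; inj₁; inj₂)
open import Data.Vec as Vec using (Vec; lookup; _∷_; [])
import Data.Vec.Properties as VecP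
open import Function using (_∘_)
open import Relation.Binary.Definitions using (DecidableEquality)
open import Relation.Binary.PropositionalEquality
  using (_≡_; refl; sym; trans; cong; cong₂; subst; subst₂; module ≡-Reasoning)
open import Relation.Nullary using (¬_; Dec; yes; no; does)
open import Relation.Nullary.Decidable using (⌊_⌋; _⊎-dec_; _×-dec_; dec-true; dec-false)
open import Algebra.Properties.Semiring.Sum ℕP.+-*-semiring
  using (sum; ∑-distrib-+; ∑-comm; sum-cong-≗; *-distribˡ-sum; sum-replicate-zero)

sumℕ-allFin : ∀ n (f : Fin n → ℕ) → sumℕ (List.map f (List.allFin n)) ≡ sum f
sumℕ-allFin n f = trans (cong sumℕ (ListP.map-tabulate (λ i → i) f)) (tabulated n f)
  where
  tabulated : ∀ n (f : Fin n → ℕ) → sumℕ (List.tabulate f) ≡ sum f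
  tabulated zero    f = refl
  tabulated (suc n) f = cong (f Fin.zero ℕ.+_) (tabulated n (f ∘ Fin.suc))

vecSum≡sum : ∀ {k} (α : Vec ℕ k) → Vec.sum α ≡ sum (lookup α)
vecSum≡sum []      = refl
vecSum≡sum (x ∷ α) = cong (x ℕ.+_) (vecSum≡sum α)

term≤sum : ∀ {n} (f : Fin n → ℕ) i → f i ≤ sum f
term≤sum f Fin.zero    = ℕP.m≤m+n _ _
term≤sum f (Fin.suc i) = ℕP.≤-trans (term≤sum (f ∘ Fin.suc) i) (ℕP.m≤n+m _ _)

δ : ∀ {n} → Fin n → Fin n → ℕ
δ p v = if ⌊ p Fin.≟ v ⌋ then 1 else 0

sum-δ : ∀ {n} (p : Fin n) → sum (δ p) ≡ 1
sum-δ {suc n} Fin.zero    = cong suc (sum-replicate-zero n)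
sum-δ {suc n} (Fin.suc p) = trans (sum-cong-≗ shift) (sum-δ p)
  where
  shift : ∀ i → δ (Fin.suc p) (Fin.suc i) ≡ δ p i
  shift i with p Fin.≟ i
  ... | yes _ = refl
  ... | no  _ = refl

ZeroOne : ∀ {k} → Vec ℕ k → Set
ZeroOne α = ∀ i → lookup α i ≤ 1

isPositive : ℕ → Bool
isPositive zero    = false
isPositive (suc _) = true

fromBool : Bool → ℕ
fromBool true  = 1
fromBool false = 0

support : ∀ {k} → Vec ℕ k → Subset k
support = Vec.map isPositive

exponents : ∀ {k} → Subset k → Vec ℕ k
exponents = Vec.map fromBool

_+V_ : ∀ {k} → Vec ℕ k → Vec ℕ k → Vec ℕ k
_+V_ = Vec.zipWith ℕ._+_

support∘exponents : ∀ {k} (T : Subset k) → support (exponents T) ≡ T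
support∘exponents []          = refl
support∘exponents (true ∷ T)  = cong (true ∷_) (support∘exponents T)
support∘exponents (false ∷ T) = cong (false ∷_) (support∘exponents T)

exponents∘support : ∀ {k} (α : Vec ℕ k) → ZeroOne α → exponents (support α) ≡ α
exponents∘support []                h = refl
exponents∘support (zero ∷ α)        h = cong (0 ∷_) (exponents∘support α (h ∘ Fin.suc))
exponents∘support (suc zero ∷ α)    h = cong (1 ∷_) (exponents∘support α (h ∘ Fin.suc))
exponents∘support (suc (suc _) ∷ α) h with h Fin.zero
... | s≤s ()

∣support∣≤degree : ∀ {k} (α : Vec ℕ k) → ∣ support α ∣ ≤ Vec.sum α
∣support∣≤degree []          = z≤n
∣support∣≤degree (zero ∷ α)  = ∣support∣≤degree α
∣support∣≤degree (suc x ∷ α) = s≤s (ℕP.≤-trans (∣support∣≤degree α) (ℕP.m≤n+m _ x))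

∣support∣≡degree : ∀ {k} (α : Vec ℕ k) → ZeroOne α → ∣ support α ∣ ≡ Vec.sum α
∣support∣≡degree []                h = refl
∣support∣≡degree (zero ∷ α)        h = ∣support∣≡degree α (h ∘ Fin.suc)
∣support∣≡degree (suc zero ∷ α)    h = cong suc (∣support∣≡degree α (h ∘ Fin.suc))
∣support∣≡degree (suc (suc _) ∷ α) h with h Fin.zero
... | s≤s ()

zeroOne-summand : ∀ {k} (w u : Vec ℕ k) → ZeroOne (w +V u) → ZeroOne u
zeroOne-summand w u h i = ℕP.≤-trans (ℕP.≤-trans (ℕP.m≤n+m (lookup u i) (lookup w i))
  (ℕP.≤-reflexive (sym (VecP.lookup-zipWith ℕ._+_ i w u)))) (h i)

-- Replacing the factor y^u of a squarefree monomial y^(w+u) by y^v is the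
-- move (support u , support v) on supports:
-- (supp(w+u) ∖ supp u) ∪ supp v = supp(w+v).
support-exchange : ∀ {k} (w u v : Vec ℕ k) → ZeroOne (w +V u) →
  (support (w +V u) ∩ ∁ (support u)) ∪ support v ≡ support (w +V v)
support-exchange []          []          []      h = refl
support-exchange (zero ∷ w)  (x ∷ u)     (y ∷ v) h =
  cong₂ _∷_ (absorb x y) (support-exchange w u v (h ∘ Fin.suc))
  where
  absorb : ∀ x y → (isPositive x ∧ not (isPositive x)) ∨ isPositive y ≡ isPositive y
  absorb zero    y = refl
  absorb (suc x) y = refl
support-exchange (suc zero ∷ w) (zero ∷ u) (y ∷ v) h =
  cong (true ∷_) (support-exchange w u v (h ∘ Fin.suc))
support-exchange (suc zero ∷ w) (suc _ ∷ u) (y ∷ v) h with h Fin.zero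
... | s≤s ()
support-exchange (suc (suc _) ∷ w) (x ∷ u) (y ∷ v) h with h Fin.zero
... | s≤s ()

module Components {a} {A : Set a} (_≟_ : DecidableEquality A) where

  -- x and y are joined by a path in L; defined by recursion on L (the
  -- last edge is used at most once), which makes it decidable.
  Joined : List (A × A) → A → A → Set a
  Joined List.[]            x y = x ≡ y
  Joined ((p , q) List.∷ L) x y =
    Joined L x y ⊎ (Joined L x p × Joined L q y) ⊎ (Joined L x q × Joined L p y)

  joined? : ∀ L x y → Dec (Joined L x y)
  joined? List.[]            x y = x ≟ y
  joined? ((p , q) List.∷ L) x y =
    joined? L x y ⊎-dec ((joined? L x p ×-dec joined? L q y) ⊎-dec (joined? L x q ×-dec joined? L p y))

  joined-refl : ∀ L x → Joined L x x
  joined-refl List.[]      x = refl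
  joined-refl (_ List.∷ L) x = inj₁ (joined-refl L x)

  joined-sym : ∀ L {x y} → Joined L x y → Joined L y x
  joined-sym List.[]      eq                    = sym eq
  joined-sym (_ List.∷ L) (inj₁ j)              = inj₁ (joined-sym L j)
  joined-sym (_ List.∷ L) (inj₂ (inj₁ (j , k))) = inj₂ (inj₂ (joined-sym L k , joined-sym L j))
  joined-sym (_ List.∷ L) (inj₂ (inj₂ (j , k))) = inj₂ (inj₁ (joined-sym L k , joined-sym L j))

  joined-trans : ∀ L {x y z} → Joined L x y → Joined L y z → Joined L x z
  joined-trans List.[]      eq eq' = trans eq eq'
  joined-trans (_ List.∷ L) (inj₁ j)              (inj₁ k)              = inj₁ (joined-trans L j k)
  joined-trans (_ List.∷ L) (inj₁ j)              (inj₂ (inj₁ (k , l))) = inj₂ (inj₁ (joined-trans L j k , l))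
  joined-trans (_ List.∷ L) (inj₁ j)              (inj₂ (inj₂ (k , l))) = inj₂ (inj₂ (joined-trans L j k , l))
  joined-trans (_ List.∷ L) (inj₂ (inj₁ (j , k))) (inj₁ l)              = inj₂ (inj₁ (j , joined-trans L k l))
  joined-trans (_ List.∷ L) (inj₂ (inj₁ (j , _))) (inj₂ (inj₁ (_ , l))) = inj₂ (inj₁ (j , l))
  joined-trans (_ List.∷ L) (inj₂ (inj₁ (j , _))) (inj₂ (inj₂ (_ , l))) = inj₁ (joined-trans L j l)
  joined-trans (_ List.∷ L) (inj₂ (inj₂ (j , k))) (inj₁ l)              = inj₂ (inj₂ (j , joined-trans L k l))
  joined-trans (_ List.∷ L) (inj₂ (inj₂ (j , _))) (inj₂ (inj₁ (_ , l))) = inj₁ (joined-trans L j l)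
  joined-trans (_ List.∷ L) (inj₂ (inj₂ (j , _))) (inj₂ (inj₂ (_ , l))) = inj₂ (inj₂ (j , l))

  joined-edges : ∀ L → All (λ e → Joined L (proj₁ e) (proj₂ e)) L
  joined-edges List.[]            = []
  joined-edges ((p , q) List.∷ L) =
    inj₂ (inj₁ (joined-refl L p , joined-refl L q)) ∷ All.map inj₁ (joined-edges L)

  sameComponent : ∀ L x {p q} → Joined L p q → does (joined? L x p) ≡ does (joined? L x q)
  sameComponent L x {p} {q} p~q with joined? L x p | joined? L x q
  ... | yes _   | yes _   = refl
  ... | no  _   | no  _   = refl
  ... | yes x~p | no  x≁q = ⊥-elim (x≁q (joined-trans L x~p p~q))
  ... | no  x≁p | yes x~q = ⊥-elim (x≁p (joined-trans L x~q (joined-sym L p~q)))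

  module _ {r} (P : A → A → Set r) (P-refl : ∀ {x} → P x x)
           (P-trans : ∀ {x y z} → P x y → P y z → P x z) where

    joined-closure : ∀ L → All (λ e → P (proj₁ e) (proj₂ e) × P (proj₂ e) (proj₁ e)) L →
      ∀ {x y} → Joined L x y → P x y
    joined-closure List.[]      _               refl                  = P-refl
    joined-closure (_ List.∷ L) (_ ∷ es)        (inj₁ j)              = joined-closure L es j
    joined-closure (_ List.∷ L) ((pq , _) ∷ es) (inj₂ (inj₁ (j , k))) =
      P-trans (joined-closure L es j) (P-trans pq (joined-closure L es k))
    joined-closure (_ List.∷ L) ((_ , qp) ∷ es) (inj₂ (inj₂ (j , k))) =
      P-trans (joined-closure L es j) (P-trans qp (joined-closure L es k))

module GraphMonomials (G : Graph) where
  open Graph G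

  image : Vec ℕ E → Fin V → ℕ
  image α v = sum λ e → lookup α e ℕ.* incidence G e v

  lookup-imageMonomial : ∀ {c ℓ} (K : CommutativeRing c ℓ) α v →
    lookup (Poly.imageMonomial K G α) v ≡ image α v
  lookup-imageMonomial K α v = trans (VecP.lookup∘tabulate _ v) (sumℕ-allFin E _)

  image-+ : ∀ w u v → image (w +V u) v ≡ image w v ℕ.+ image u v
  image-+ w u v = trans (sum-cong-≗ distrib)
    (∑-distrib-+ (λ e → lookup w e ℕ.* incidence G e v) (λ e → lookup u e ℕ.* incidence G e v))
    where
    distrib : ∀ e → lookup (w +V u) e ℕ.* incidence G e v
                  ≡ lookup w e ℕ.* incidence G e v ℕ.+ lookup u e ℕ.* incidence G e v
    distrib e rewrite VecP.lookup-zipWith ℕ._+_ e w u =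
      ℕP.*-distribʳ-+ (incidence G e v) (lookup w e) (lookup u e)

  sum-incidence : ∀ e → sum (incidence G e) ≡ 2
  sum-incidence e = trans (∑-distrib-+ (δ (proj₁ (ends e))) (δ (proj₂ (ends e))))
    (cong₂ ℕ._+_ (sum-δ (proj₁ (ends e))) (sum-δ (proj₂ (ends e))))

  sum-image : ∀ α → sum (image α) ≡ 2 ℕ.* Vec.sum α
  sum-image α = begin
    sum (image α)                                         ≡⟨ ∑-comm (λ v e → lookup α e ℕ.* incidence G e v) ⟩
    sum (λ e → sum λ v → lookup α e ℕ.* incidence G e v)  ≡⟨ sum-cong-≗ factor ⟨
    sum (λ e → lookup α e ℕ.* sum (incidence G e))        ≡⟨ sum-cong-≗ twice ⟩
    sum (λ e → 2 ℕ.* lookup α e)                          ≡⟨ *-distribˡ-sum 2 (lookup α) ⟨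
    2 ℕ.* sum (lookup α)                                  ≡⟨ cong (2 ℕ.*_) (vecSum≡sum α) ⟨
    2 ℕ.* Vec.sum α                                       ∎
    where
    open ≡-Reasoning
    factor : ∀ e → lookup α e ℕ.* sum (incidence G e) ≡ sum λ v → lookup α e ℕ.* incidence G e v
    factor e = *-distribˡ-sum (lookup α e) (incidence G e)
    twice : ∀ e → lookup α e ℕ.* sum (incidence G e) ≡ 2 ℕ.* lookup α e
    twice e = trans (cong (lookup α e ℕ.*_) (sum-incidence e)) (ℕP.*-comm (lookup α e) 2)

  sameImage⇒sameDegree : ∀ u v → (∀ x → image u x ≡ image v x) → Vec.sum u ≡ Vec.sum v
  sameImage⇒sameDegree u v eq = ℕP.*-cancelˡ-≡ (Vec.sum u) (Vec.sum v) 2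
    (trans (sym (sum-image u)) (trans (sum-cong-≗ eq) (sum-image v)))

  CoversOnce : Vec ℕ E → Set
  CoversOnce α = ∀ v → image α v ≡ 1

  -- such a monomial is squarefree: y_e² would cover an endpoint of e twice
  coversOnce⇒zeroOne : ∀ α → CoversOnce α → ZeroOne α
  coversOnce⇒zeroOne α cov e = begin
    lookup α e                             ≡⟨ sym (ℕP.*-identityʳ (lookup α e)) ⟩
    lookup α e ℕ.* 1                       ≤⟨ ℕP.*-monoʳ-≤ (lookup α e) first-endpoint ⟩
    lookup α e ℕ.* incidence G e p         ≤⟨ term≤sum (λ e' → lookup α e' ℕ.* incidence G e' p) e ⟩
    image α p                              ≡⟨ cov p ⟩
    1                                      ∎
    where
    open ℕP.≤-Reasoning
    p = proj₁ (ends e)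
    first-endpoint : 1 ≤ incidence G e p
    first-endpoint with p Fin.≟ p
    ... | yes _ = s≤s z≤n
    ... | no p≢p = ⊥-elim (p≢p refl)

  coverCount≡image : ∀ T v → coverCount G T v ≡ image (exponents T) v
  coverCount≡image T v = trans (sumℕ-allFin E _) (sum-cong-≗ term)
    where
    term : ∀ e → (if lookup T e then incidence G e v else 0)
               ≡ lookup (exponents T) e ℕ.* incidence G e v
    term e rewrite VecP.lookup-map e fromBool T with lookup T e
    ... | true  = sym (ℕP.+-identityʳ _)
    ... | false = refl

  tiling⇒coversOnce : ∀ {T} → IsTiling G T → CoversOnce (exponents T)
  tiling⇒coversOnce {T} t v = trans (sym (coverCount≡image T v)) (t v)

  coversOnce⇒tiling : ∀ α → CoversOnce α → IsTiling G (support α)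
  coversOnce⇒tiling α cov v = begin
    coverCount G (support α) v       ≡⟨ coverCount≡image (support α) v ⟩
    image (exponents (support α)) v  ≡⟨ cong (λ β → image β v) squarefree ⟩
    image α v                        ≡⟨ cov v ⟩
    1                                ∎
    where
    open ≡-Reasoning
    squarefree : exponents (support α) ≡ α
    squarefree = exponents∘support α (coversOnce⇒zeroOne α cov)

  reachable-trans : ∀ {d T T' T''} → Reachable G d T T' → Reachable G d T' T'' → Reachable G d T T''
  reachable-trans done            r' = r'
  reachable-trans (step M s t r)  r' = step M s t (reachable-trans r r')

  Leads : ℕ → Vec ℕ E → Vec ℕ E → Set
  Leads d x y = CoversOnce x → CoversOnce y × Reachable G d (support x) (support y)

  leads-refl : ∀ {d x} → Leads d x x
  leads-refl cov = cov , done

  leads-trans : ∀ {d x y z} → Leads d x y → Leads d y z → Leads d x z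
  leads-trans x→y y→z covx =
    let covy , rxy = x→y covx
        covz , ryz = y→z covy
    in covz , reachable-trans rxy ryz

  exchange-leads : ∀ {d} w u v → (∀ x → image u x ≡ image v x) → Vec.sum u ≤ d →
    Leads d (w +V u) (w +V v)
  exchange-leads {d} w u v same deg≤d cov = cov' , step M size tiling arrived
    where
    cov' : CoversOnce (w +V v)
    cov' x = begin
      image (w +V v) x          ≡⟨ image-+ w v x ⟩
      image w x ℕ.+ image v x   ≡⟨ cong (image w x ℕ.+_) (sym (same x)) ⟩
      image w x ℕ.+ image u x   ≡⟨ sym (image-+ w u x) ⟩
      image (w +V u) x          ≡⟨ cov x ⟩
      1                         ∎
      where open ≡-Reasoning
    M : Move G
    M = support u , support v
    size : SizeAtMost G d M
    size = trans (∣support∣≡degree u (zeroOne-summand w u (coversOnce⇒zeroOne (w +V u) cov)))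
             (trans (sameImage⇒sameDegree u v same)
               (sym (∣support∣≡degree v (zeroOne-summand w v (coversOnce⇒zeroOne (w +V v) cov')))))
         , ℕP.≤-trans (∣support∣≤degree u) deg≤d
    exchanged : _+M_ G (support (w +V u)) M ≡ support (w +V v)
    exchanged = support-exchange w u v (coversOnce⇒zeroOne (w +V u) cov)
    tiling : IsTiling G (_+M_ G (support (w +V u)) M)
    tiling = subst (IsTiling G) (sym exchanged) (coversOnce⇒tiling (w +V v) cov')
    arrived : Reachable G d (_+M_ G (support (w +V u)) M) (support (w +V v))
    arrived = subst (λ T → Reachable G d T (support (w +V v))) (sym exchanged) done

module CoefficientSums {c ℓ} (K : CommutativeRing c ℓ) (k : ℕ) where
  open CommutativeRing K renaming (refl to ≈-refl; reflexive to ≈-reflexive; sym to ≈-sym; trans to ≈-trans)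
  open Poly K
  open import Relation.Binary.Reasoning.Setoid setoid

  _≟ₘ_ : DecidableEquality (Monomial k)
  _≟ₘ_ = VecP.≡-dec ℕ._≟_

  [_]_ : Bool → Carrier → Carrier
  [ b ] x = if b then x else 0#

  [_]-cong : ∀ b {x y} → x ≈ y → [ b ] x ≈ [ b ] y
  [ true  ]-cong x≈y = x≈y
  [ false ]-cong _   = ≈-refl

  [_]-zero : ∀ b → [ b ] 0# ≈ 0#
  [ true  ]-zero = ≈-refl
  [ false ]-zero = ≈-refl

  [_]-+ : ∀ b x y → [ b ] (x + y) ≈ [ b ] x + [ b ] y
  [ true  ]-+ x y = ≈-refl
  [ false ]-+ x y = ≈-sym (+-identityʳ 0#)

  coeffSum : (Monomial k → Bool) → Polynomial k → Carrier
  coeffSum S List.[]            = 0#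
  coeffSum S ((a , β) List.∷ p) = [ S β ] a + coeffSum S p

  coeffSum-++ : ∀ S p q → coeffSum S (p ++ q) ≈ coeffSum S p + coeffSum S q
  coeffSum-++ S List.[]            q = ≈-sym (+-identityˡ _)
  coeffSum-++ S ((a , β) List.∷ p) q = ≈-trans (+-congˡ (coeffSum-++ S p q)) (≈-sym (+-assoc _ _ _))

  without : Monomial k → Polynomial k → Polynomial k
  without β List.[]            = List.[]
  without β ((a , γ) List.∷ p) = if ⌊ γ ≟ₘ β ⌋ then without β p else (a , γ) List.∷ without β p

  length-without : ∀ β p → List.length (without β p) ≤ List.length p
  length-without β List.[]            = z≤n
  length-without β ((a , γ) List.∷ p) with γ ≟ₘ β
  ... | yes _ = ℕP.m≤n⇒m≤1+n (length-without β p)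
  ... | no  _ = s≤s (length-without β p)

  length-without-head : ∀ a β p → List.length (without β ((a , β) List.∷ p)) ≤ List.length p
  length-without-head a β p with β ≟ₘ β
  ... | yes _   = length-without β p
  ... | no  β≢β = ⊥-elim (β≢β refl)

  coeff-cons-other : ∀ a γ p α → ¬ (γ ≡ α) → coeff ((a , γ) List.∷ p) α ≡ coeff p α
  coeff-cons-other a γ p α γ≢α with γ ≟ₘ α
  ... | yes γ≡α = ⊥-elim (γ≢α γ≡α)
  ... | no  _   = refl

  coeff-cons-cong : ∀ a γ α {p q} → coeff p α ≈ coeff q α →
    coeff ((a , γ) List.∷ p) α ≈ coeff ((a , γ) List.∷ q) α
  coeff-cons-cong a γ α p≈q with γ ≟ₘ α
  ... | yes _ = +-congˡ p≈q
  ... | no  _ = p≈q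

  coeff-without-same : ∀ β p → coeff (without β p) β ≈ 0#
  coeff-without-same β List.[]            = ≈-refl
  coeff-without-same β ((a , γ) List.∷ p) with γ ≟ₘ β
  ... | yes _   = coeff-without-same β p
  ... | no  γ≢β = ≈-trans (≈-reflexive (coeff-cons-other a γ (without β p) β γ≢β)) (coeff-without-same β p)

  coeff-without-other : ∀ β α p → ¬ (β ≡ α) → coeff (without β p) α ≈ coeff p α
  coeff-without-other β α List.[]            β≢α = ≈-refl
  coeff-without-other β α ((a , γ) List.∷ p) β≢α with γ ≟ₘ β
  ... | yes refl = ≈-trans (coeff-without-other β α p β≢α)
                     (≈-reflexive (sym (coeff-cons-other a β p α β≢α)))
  ... | no  _    = coeff-cons-cong a γ α {without β p} {p} (coeff-without-other β α p β≢α)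

  without-cong : ∀ β {p q} → p ≈P q → without β p ≈P without β q
  without-cong β {p} {q} p≈q α with β ≟ₘ α
  ... | yes refl = ≈-trans (coeff-without-same β p) (≈-sym (coeff-without-same β q))
  ... | no  β≢α  = ≈-trans (coeff-without-other β α p β≢α)
                     (≈-trans (p≈q α) (≈-sym (coeff-without-other β α q β≢α)))

  coeffSum-split : ∀ S β p → coeffSum S p ≈ [ S β ] (coeff p β) + coeffSum S (without β p)
  coeffSum-split S β List.[] = ≈-sym (≈-trans (+-identityʳ _) [ S β ]-zero)
  coeffSum-split S β ((a , γ) List.∷ p) with γ ≟ₘ β
  ... | yes refl = begin
        [ S γ ] a + coeffSum S p                                        ≈⟨ +-congˡ (coeffSum-split S γ p) ⟩
        [ S γ ] a + ([ S γ ] (coeff p γ) + coeffSum S (without γ p))    ≈⟨ +-assoc _ _ _ ⟨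
        ([ S γ ] a + [ S γ ] (coeff p γ)) + coeffSum S (without γ p)    ≈⟨ +-congʳ ([ S γ ]-+ a (coeff p γ)) ⟨
        [ S γ ] (a + coeff p γ) + coeffSum S (without γ p)              ∎
  ... | no  _    = begin
        [ S γ ] a + coeffSum S p                                        ≈⟨ +-congˡ (coeffSum-split S β p) ⟩
        [ S γ ] a + ([ S β ] (coeff p β) + coeffSum S (without β p))    ≈⟨ x+[y+z]≈y+[x+z] _ _ _ ⟩
        [ S β ] (coeff p β) + ([ S γ ] a + coeffSum S (without β p))    ∎
    where
    x+[y+z]≈y+[x+z] : ∀ x y z → x + (y + z) ≈ y + (x + z)
    x+[y+z]≈y+[x+z] x y z = ≈-trans (≈-sym (+-assoc x y z)) (≈-trans (+-congʳ (+-comm x y)) (+-assoc y x z))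

  -- coeffSum S depends only on the coefficients; induction on the total
  -- number of terms, removing one monomial from both sides at a time
  coeffSum-cong : ∀ S p q → p ≈P q → coeffSum S p ≈ coeffSum S q
  coeffSum-cong S p q = bounded (List.length p ℕ.+ List.length q) p q ℕP.≤-refl
    where
    bounded : ∀ n p q → List.length p ℕ.+ List.length q ≤ n → p ≈P q → coeffSum S p ≈ coeffSum S q
    removing : ∀ n a β p q → List.length p ℕ.+ List.length q ≤ n →
      ((a , β) List.∷ p) ≈P q → coeffSum S ((a , β) List.∷ p) ≈ coeffSum S q
    removing n a β p q len p≈q = begin
      coeffSum S ((a , β) List.∷ p)                               ≈⟨ coeffSum-split S β ((a , β) List.∷ p) ⟩
      [ S β ] (coeff ((a , β) List.∷ p) β) + coeffSum S p′        ≈⟨ +-cong ([ S β ]-cong (p≈q β)) smaller ⟩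
      [ S β ] (coeff q β) + coeffSum S (without β q)              ≈⟨ coeffSum-split S β q ⟨
      coeffSum S q                                                ∎
      where
      p′ : Polynomial k
      p′ = without β ((a , β) List.∷ p)
      shorter : List.length p′ ℕ.+ List.length (without β q) ≤ n
      shorter = ℕP.≤-trans (ℕP.+-mono-≤ (length-without-head a β p) (length-without β q)) len
      smaller : coeffSum S p′ ≈ coeffSum S (without β q)
      smaller = bounded n p′ (without β q) shorter (without-cong β {(a , β) List.∷ p} {q} p≈q)

    bounded n       List.[]            List.[]            _   _   = ≈-refl
    bounded (suc n) ((a , β) List.∷ p) q                  len p≈q = removing n a β p q (ℕP.≤-pred len) p≈q
    bounded (suc n) List.[]            ((a , β) List.∷ q) len p≈q =
      ≈-sym (removing n a β q List.[] (ℕP.≤-trans (ℕP.≤-reflexive (ℕP.+-identityʳ _)) (ℕP.≤-pred len))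
               (λ α → ≈-sym (p≈q α)))

  shiftedPairs : Polynomial k → Monomial k → Monomial k → List (Monomial k × Monomial k)
  shiftedPairs q u v = List.map (λ t → (proj₂ t +V u , proj₂ t +V v)) q

  Unseparated : (Monomial k → Bool) → Monomial k × Monomial k → Set
  Unseparated S e = S (proj₁ e) ≡ S (proj₂ e)

  coeffSum-binomialMultiple : ∀ S u v q → All (Unseparated S) (shiftedPairs q u v) →
    coeffSum S (q *P binomial u v) ≈ 0#
  coeffSum-binomialMultiple S u v List.[]            []             = ≈-refl
  coeffSum-binomialMultiple S u v ((a , w) List.∷ q) (same ∷ rest) = begin
    [ S (w +V u) ] (a * 1#) + ([ S (w +V v) ] (a * - 1#) + coeffSum S (q *P binomial u v))
      ≈⟨ cancel (S (w +V u)) (S (w +V v)) same ⟩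
    coeffSum S (q *P binomial u v)
      ≈⟨ coeffSum-binomialMultiple S u v q rest ⟩
    0# ∎
    where
    x : Carrier
    x = coeffSum S (q *P binomial u v)
    a1+a[-1]≈0 : a * 1# + a * - 1# ≈ 0#
    a1+a[-1]≈0 = ≈-trans (≈-sym (distribˡ a 1# (- 1#))) (≈-trans (*-congˡ (-‿inverseʳ 1#)) (zeroʳ a))
    cancel : ∀ b b′ → b ≡ b′ → [ b ] (a * 1#) + ([ b′ ] (a * - 1#) + x) ≈ x
    cancel true  .true  refl = ≈-trans (≈-sym (+-assoc _ _ _)) (≈-trans (+-congʳ a1+a[-1]≈0) (+-identityˡ x))
    cancel false .false refl = ≈-trans (+-identityˡ _) (+-identityˡ x)


module MoveGraphs {c ℓ} (K : CommutativeRing c ℓ) (k : ℕ) where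
  open CommutativeRing K hiding (sym) renaming (refl to ≈-refl; trans to ≈-trans)
  open Poly K
  open CoefficientSums K k
  open import Relation.Binary.Reasoning.Setoid setoid

  binomials : ∀ {r} → Vec (Monomial k × Monomial k) r → Vec (Polynomial k) r
  binomials = Vec.map (λ uv → binomial (proj₁ uv) (proj₂ uv))

  combination : ∀ {r} → Vec (Polynomial k) r → Vec (Monomial k × Monomial k) r → Polynomial k
  combination qs gens = sumP (Vec.zipWith _*P_ qs (binomials gens))

  moveGraph : ∀ {r} → Vec (Polynomial k) r → Vec (Monomial k × Monomial k) r → List (Monomial k × Monomial k)
  moveGraph []       []              = List.[]
  moveGraph (q ∷ qs) ((u , v) ∷ gens) = shiftedPairs q u v ++ moveGraph qs gens

  coeffSum-combination : ∀ S {r} (qs : Vec (Polynomial k) r) gens →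
    All (Unseparated S) (moveGraph qs gens) → coeffSum S (combination qs gens) ≈ 0#
  coeffSum-combination S []       []               _     = ≈-refl
  coeffSum-combination S (q ∷ qs) ((u , v) ∷ gens) unsep =
    let here , rest = AllP.++⁻ (shiftedPairs q u v) unsep in begin
    coeffSum S (q *P binomial u v ++ combination qs gens)              ≈⟨ coeffSum-++ S (q *P binomial u v) _ ⟩
    coeffSum S (q *P binomial u v) + coeffSum S (combination qs gens)
      ≈⟨ +-cong (coeffSum-binomialMultiple S u v q here) (coeffSum-combination S qs gens rest) ⟩
    0# + 0#                                                            ≈⟨ +-identityʳ 0# ⟩
    0#                                                                 ∎

  open Components _≟ₘ_

  -- Diaconis–Sturmfels: if y^x - y^y = Σᵢ qᵢ (y^uᵢ - y^vᵢ) over a nontrivial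
  -- ring, then x and y are joined in the move graph.  Otherwise the sum of
  -- coefficients over the component of x would be 1 on the left and 0 on
  -- the right.
  binomial-joined : ¬ (1# ≈ 0#) → ∀ {r} (qs : Vec (Polynomial k) r) gens x y →
    binomial x y ≈P combination qs gens → Joined (moveGraph qs gens) x y
  binomial-joined 1≉0 qs gens x y x-y≈comb = decide (joined? L x y)
    where
    L : List (Monomial k × Monomial k)
    L = moveGraph qs gens
    component : Monomial k → Bool
    component z = does (joined? L x z)
    unseparated : All (Unseparated component) L
    unseparated = All.map (sameComponent L x) (joined-edges L)
    separates : ∀ b b′ → b ≡ true → b′ ≡ false → [ b ] 1# + ([ b′ ] (- 1#) + 0#) ≈ 1#
    separates .true .false refl refl = ≈-trans (+-congˡ (+-identityʳ 0#)) (+-identityʳ 1#)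
    decide : Dec (Joined L x y) → Joined L x y
    decide (yes x~y) = x~y
    decide (no  x≁y) = ⊥-elim (1≉0 (begin
      1#                                        ≈⟨ separates (component x) (component y) x∈ y∉ ⟨
      coeffSum component (binomial x y)
        ≈⟨ coeffSum-cong component (binomial x y) (combination qs gens) x-y≈comb ⟩
      coeffSum component (combination qs gens)  ≈⟨ coeffSum-combination component qs gens unseparated ⟩
      0#                                        ∎))
      where
      x∈ : component x ≡ true
      x∈ = dec-true (joined? L x x) (joined-refl L x)
      y∉ : component y ≡ false
      y∉ = dec-false (joined? L x y) x≁y

module ToricBinomials {c ℓ} (K : CommutativeRing c ℓ) (G : Graph) where
  open CommutativeRing K renaming (refl to ≈-refl; sym to ≈-sym; trans to ≈-trans)
  open Poly K
  open GraphMonomials G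
  open Graph G using (V; E)

  imageMonomial-cong : ∀ {u v} → (∀ x → image u x ≡ image v x) → imageMonomial G u ≡ imageMonomial G v
  imageMonomial-cong same = VecP.tabulate-cong λ x →
    trans (sumℕ-allFin E _) (trans (same x) (sym (sumℕ-allFin E _)))

  sameImage⇒toric : ∀ u v → (∀ x → image u x ≡ image v x) → InToricIdeal G (binomial u v)
  sameImage⇒toric u v same α rewrite imageMonomial-cong {u} {v} same
    with VecP.≡-dec ℕ._≟_ (imageMonomial G v) α
  ... | yes _ = ≈-trans (+-congˡ (+-identityʳ (- 1#))) (-‿inverseʳ 1#)
  ... | no  _ = ≈-refl

  toric⇒sameImage : ¬ (1# ≈ 0#) → ∀ u v → InToricIdeal G (binomial u v) → ∀ x → image u x ≡ image v x
  toric⇒sameImage 1≉0 u v toric x =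
    trans (sym (lookup-imageMonomial K u x))
      (trans (cong (λ I → lookup I x) sameImageMonomial) (lookup-imageMonomial K v x))
    where
    Iu Iv : Vec ℕ V
    Iu = imageMonomial G u
    Iv = imageMonomial G v
    -- the coefficient of x^Iu in the image of y^u - y^v is 1 unless Iu = Iv
    sameImageMonomial : Iu ≡ Iv
    sameImageMonomial with VecP.≡-dec ℕ._≟_ Iu Iu | VecP.≡-dec ℕ._≟_ Iv Iu | toric Iu
    ... | _        | yes Iv≡Iu | _       = sym Iv≡Iu
    ... | yes _    | no  _     | coeff≈0 = ⊥-elim (1≉0 (≈-trans (≈-sym (+-identityʳ 1#)) coeff≈0))
    ... | no  Iu≢Iu | no  _    | _       = ⊥-elim (Iu≢Iu refl)

module TilingMoves {c ℓ} (K : Field c ℓ) (G : Graph) (d : ℕ) where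
  open Field K using (commutativeRing; 1≉0)
  open Poly commutativeRing
  open Graph G using (E)
  open GraphMonomials G
  open ToricBinomials commutativeRing G
  open CoefficientSums commutativeRing E using (_≟ₘ_; shiftedPairs)
  open MoveGraphs commutativeRing E
  open Components _≟ₘ_

  GoodGenerator : Monomial E × Monomial E → Set ℓ
  GoodGenerator (u , v) = degree u ≤ d × degree v ≤ d × InToricIdeal G (binomial u v)

  BothWays : Monomial E × Monomial E → Set
  BothWays (x , y) = Leads d x y × Leads d y x

  shiftedPairs-bothWays : ∀ u v → GoodGenerator (u , v) → ∀ q → All BothWays (shiftedPairs q u v)
  shiftedPairs-bothWays u v (du , dv , toric) q =
    AllP.map⁺ (All.universal (λ t → exchange-leads (proj₂ t) u v same du ,
                                     exchange-leads (proj₂ t) v u (sym ∘ same) dv) q)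
    where
    same : ∀ x → image u x ≡ image v x
    same = toric⇒sameImage 1≉0 u v toric

  moveGraph-bothWays : ∀ {r} (gens : Vec (Monomial E × Monomial E) r) →
    (∀ i → GoodGenerator (lookup gens i)) → ∀ qs → All BothWays (moveGraph qs gens)
  moveGraph-bothWays []               good []       = []
  moveGraph-bothWays ((u , v) ∷ gens) good (q ∷ qs) =
    AllP.++⁺ (shiftedPairs-bothWays u v (good Fin.zero) q) (moveGraph-bothWays gens (good ∘ Fin.suc) qs)

  tilingsConnected : ToricIdealGeneratedInDegreeAtMost G d → TilingsConnectedBySizeAtMost G d
  tilingsConnected (r , gens , good , generates) T₁ T₂ t₁ t₂ =
    subst₂ (Reachable G d) (support∘exponents T₁) (support∘exponents T₂)
      (proj₂ (x₁-leads-x₂ (tiling⇒coversOnce {T₁} t₁)))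
    where
    x₁ x₂ : Monomial E
    x₁ = exponents T₁
    x₂ = exponents T₂
    -- both tiling monomials map to x_1 ⋯ x_V, so y^x₁ - y^x₂ is toric
    toric : InToricIdeal G (binomial x₁ x₂)
    toric = sameImage⇒toric x₁ x₂ λ v →
      trans (tiling⇒coversOnce {T₁} t₁ v) (sym (tiling⇒coversOnce {T₂} t₂ v))
    qs : Vec (Polynomial E) r
    qs = proj₁ (generates (binomial x₁ x₂) toric)
    x₁-x₂≈comb : binomial x₁ x₂ ≈P combination qs gens
    x₁-x₂≈comb = proj₂ (generates (binomial x₁ x₂) toric)
    x₁-leads-x₂ : Leads d x₁ x₂
    x₁-leads-x₂ = joined-closure (Leads d) leads-refl leads-trans (moveGraph qs gens)
      (moveGraph-bothWays gens good qs) (binomial-joined 1≉0 qs gens x₁ x₂ x₁-x₂≈comb)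

mainTheorem3 : ∀ {c ℓ} (K : Field c ℓ) (n N : ℕ) (R : Region n N) (d : ℕ) →
    Poly.ToricIdealGeneratedInDegreeAtMost (Field.commutativeRing K) (graphOf R) d →
    TilingsConnectedBySizeAtMost (graphOf R) d
mainTheorem3 K n N R d = TilingMoves.tilingsConnected K (graphOf R) d
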